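{- For every $\varepsilon>0$ there exists $N_0$ such that for every $N\ge N_0$ and every coloring of the edges of the complete graph $K_N$ with the two colors red and blue, the ratio \[ \frac{\#\{\text{monochromatic paths of length 2 in } K_N \text{ that lie in a monochromatic triangle}\}}{\#\{\text{monochromatic paths of length 2 in } K_N\}} \] is at least $\tfrac12-\varepsilon$. That is, this ratio is asymptotically at least $0.5$ as $N\to\infty$, uniformly over all red/blue colorings.
   Context: A path of length 2 is a pair of distinct edges $\{u,v\},\{v,w\}$ sharing exactly one vertex (with $u\ne w$), considered as an unordered pair of edges; it is monochromatic if both edges have the same color, and it lies in a monochromatic triangle if the edge $\{u,w\}$ has that same color as well. A monochromatic triangle is a set of three vertices all three of whose connecting edges have the same color. -}

module Defs where

open import Data.Nat using (ℕ; zero; suc; _+_)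
open import Data.Bool using (Bool; true; false; _∧_; not)
open import Data.Fin using (Fin)
open import Data.Fin.Properties using (_<?_)
import Data.Fin.Properties as FinP
import Data.Bool.Properties as BoolP
open import Data.List using (List; map; allFin)
open import Data.Nat.ListAction using (sum)
open import Relation.Nullary using (does)
open import Relation.Binary.PropositionalEquality using (_≡_)

-- A red/blue colouring of the edges of K_N: a symmetric function
-- c : Fin N → Fin N → Bool (true = red, false = blue). Values on the
-- diagonal (c v v) are irrelevant and never used by the counts below.
Colouring : ℕ → Set
Colouring N = Fin N → Fin N → Bool

Symmetric : ∀ {N} → Colouring N → Set
Symmetric {N} c = (u v : Fin N) → c u v ≡ c v u

⟦_⟧ : Bool → ℕ
⟦ true ⟧ = 1
⟦ false ⟧ = 0

∑ : ∀ {N} → (Fin N → ℕ) → ℕ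
∑ {N} f = sum (map f (allFin N))

_=ᶠ_ : ∀ {N} → Fin N → Fin N → Bool
u =ᶠ v = does (u FinP.≟ v)

_=ᵇ_ : Bool → Bool → Bool
a =ᵇ b = does (a BoolP.≟ b)

-- A path of length 2 is an unordered pair of edges {v,u},{v,w} with u ≠ w,
-- u ≠ v, w ≠ v.  It is determined by its centre v and the unordered pair
-- {u,w}, which we enumerate once by requiring u < w.
isPath2 : ∀ {N} → Fin N → Fin N → Fin N → Bool
isPath2 v u w = does (u <? w) ∧ not (u =ᶠ v) ∧ not (w =ᶠ v)

isMonoPath2 : ∀ {N} → Colouring N → Fin N → Fin N → Fin N → Bool
isMonoPath2 c v u w = isPath2 v u w ∧ (c v u =ᵇ c v w)

isMonoPath2InTriangle : ∀ {N} → Colouring N → Fin N → Fin N → Fin N → Bool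
isMonoPath2InTriangle c v u w = isMonoPath2 c v u w ∧ (c u w =ᵇ c v u)

monoPaths : ∀ {N} → Colouring N → ℕ
monoPaths c = ∑ λ v → ∑ λ u → ∑ λ w → ⟦ isMonoPath2 c v u w ⟧

monoPathsInTriangle : ∀ {N} → Colouring N → ℕ
monoPathsInTriangle c = ∑ λ v → ∑ λ u → ∑ λ w → ⟦ isMonoPath2InTriangle c v u w ⟧

module Submission where

-- Count wedges (v; u, w): ordered pairs of distinct neighbours u, w of a centre v. Every path of
-- length 2 gives two wedges, so it suffices to compare M monochromatic wedges, T closed ones
-- (lying in a monochromatic triangle) and Q bichromatic ones. A monochromatic triangle carries three
-- closed wedges, any other triangle one open monochromatic wedge and two bichromatic ones; summing
-- over triangles gives Goodman's identity 2M = 2T + Q. At a centre with r red and b blue neighbours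
-- there are r² + b² − (r + b) monochromatic and 2rb ≤ r² + b² bichromatic wedges, so Q exceeds M
-- by at most N(N − 1). Since M is of order N³ this forces T ≥ (½ − O(1/N)) M; explicitly
-- k M ≤ 2(2 + k) T as soon as N ≥ 5 + k.

open import Defs

module Counting where

  open import Data.Bool using (Bool; true; false; _∧_; not)
  open import Data.Bool.Properties using (∧-assoc; ∧-comm)
  open import Data.Fin using (Fin; zero; suc)
  open import Data.Fin.Properties using (_<?_; _≟_; <-cmp)
  open import Data.List using (tabulate)
  open import Data.List.Properties using (map-tabulate)
  import Data.Nat.ListAction as List
  open import Data.Nat using (ℕ; zero; suc; _+_; _*_; _∸_; _≤_; z≤n; s≤s⁻¹)
  open import Data.Nat.Properties
    using ( +-*-semiring; +-comm; +-assoc; +-identityʳ; *-identityˡ; *-identityʳ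
          ; *-distribˡ-+; *-distribʳ-+; *-cancelˡ-≡; *-cancelˡ-≤; m+[n∸m]≡n; m≤m+n
          ; ≤-total; ≤-trans; ≤-reflexive; +-mono-≤; +-monoʳ-≤; *-monoʳ-≤; *-monoˡ-≤
          ; +-cancelʳ-≤; module ≤-Reasoning)
  open import Data.Nat.Tactic.RingSolver using (solve-∀)
  open import Data.Sum using (inj₁; inj₂)
  open import Algebra.Properties.Semiring.Sum +-*-semiring
    using (sum; sum-cong-≗; ∑-comm; ∑-distrib-+; *-distribˡ-sum; *-distribʳ-sum; sum-replicate-zero)
  open import Function using (_∘_; id; mk⇔)
  open import Relation.Binary.Definitions using (tri<; tri≈; tri>)
  open import Relation.Nullary.Decidable using (does; dec-true; dec-false; does-⇔)
  open import Relation.Binary.PropositionalEquality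

  ⟦⟧-homo-∧ : ∀ x y → ⟦ x ∧ y ⟧ ≡ ⟦ x ⟧ * ⟦ y ⟧
  ⟦⟧-homo-∧ false y = refl
  ⟦⟧-homo-∧ true  y = sym (+-identityʳ ⟦ y ⟧)

  ⟦⟧-idem : ∀ x → ⟦ x ⟧ * ⟦ x ⟧ ≡ ⟦ x ⟧
  ⟦⟧-idem false = refl
  ⟦⟧-idem true  = refl

  ⟦⟧*n≤n : ∀ x n → ⟦ x ⟧ * n ≤ n
  ⟦⟧*n≤n false n = z≤n
  ⟦⟧*n≤n true  n = ≤-reflexive (+-identityʳ n)

  ⟦not⟧+⟦⟧≡1 : ∀ x → ⟦ not x ⟧ + ⟦ x ⟧ ≡ 1
  ⟦not⟧+⟦⟧≡1 false = refl
  ⟦not⟧+⟦⟧≡1 true  = refl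

  =ᶠ-comm : ∀ {n} (u w : Fin n) → (u =ᶠ w) ≡ (w =ᶠ u)
  =ᶠ-comm u w = does-⇔ (mk⇔ sym sym) (u ≟ w) (w ≟ u)

  =ᵇ-comm : ∀ a b → (a =ᵇ b) ≡ (b =ᵇ a)
  =ᵇ-comm false false = refl
  =ᵇ-comm false true  = refl
  =ᵇ-comm true  false = refl
  =ᵇ-comm true  true  = refl

  ∑≡sum : ∀ {n} (f : Fin n → ℕ) → ∑ f ≡ sum f
  ∑≡sum f = trans (cong List.sum (map-tabulate id f)) (listSum-tabulate f)
    where
    listSum-tabulate : ∀ {n} (f : Fin n → ℕ) → List.sum (tabulate f) ≡ sum f
    listSum-tabulate {zero} f = refl
    listSum-tabulate {suc n} f = cong (f zero +_) (listSum-tabulate (f ∘ suc))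

  sum-mono-≤ : ∀ {n} {f g : Fin n → ℕ} → (∀ i → f i ≤ g i) → sum f ≤ sum g
  sum-mono-≤ {zero} f≤g = z≤n
  sum-mono-≤ {suc n} f≤g = +-mono-≤ (f≤g zero) (sum-mono-≤ (f≤g ∘ suc))

  sum-ones : ∀ n → sum {n} (λ _ → 1) ≡ n
  sum-ones zero = refl
  sum-ones (suc n) = cong suc (sum-ones n)

  sum-δ : ∀ {n} (v : Fin n) (f : Fin n → ℕ) → sum (λ u → ⟦ v =ᶠ u ⟧ * f u) ≡ f v
  sum-δ {suc n} zero f = trans (cong₂ _+_ (*-identityˡ (f zero)) (sum-replicate-zero n)) (+-identityʳ (f zero))
  sum-δ (suc v) f = sum-δ v (f ∘ suc)

  ∑² : ∀ {n} → (Fin n → Fin n → ℕ) → ℕ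
  ∑² f = sum λ u → sum λ w → f u w

  ∑²-cong : ∀ {n} {f g : Fin n → Fin n → ℕ} → (∀ u w → f u w ≡ g u w) → ∑² f ≡ ∑² g
  ∑²-cong f≡g = sum-cong-≗ λ u → sum-cong-≗ (f≡g u)

  ∑²-distrib-+ : ∀ {n} (f g : Fin n → Fin n → ℕ) → ∑² (λ u w → f u w + g u w) ≡ ∑² f + ∑² g
  ∑²-distrib-+ f g = trans (sum-cong-≗ λ u → ∑-distrib-+ (f u) (g u))
                           (∑-distrib-+ (λ u → sum (f u)) (λ u → sum (g u)))

  *-distribˡ-∑² : ∀ {n} k (f : Fin n → Fin n → ℕ) → k * ∑² f ≡ ∑² (λ u w → k * f u w)
  *-distribˡ-∑² k f = trans (*-distribˡ-sum k λ u → sum (f u)) (sum-cong-≗ λ u → *-distribˡ-sum k (f u))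

  ∑²-mono-≤ : ∀ {n} {f g : Fin n → Fin n → ℕ} → (∀ u w → f u w ≤ g u w) → ∑² f ≤ ∑² g
  ∑²-mono-≤ f≤g = sum-mono-≤ λ u → sum-mono-≤ (f≤g u)

  ∑²-product : ∀ {n} (f g : Fin n → ℕ) → ∑² (λ u w → f u * g w) ≡ sum f * sum g
  ∑²-product f g = trans (sum-cong-≗ (λ u → sym (*-distribˡ-sum (f u) g))) (sym (*-distribʳ-sum (sum g) f))

  ∑²-offDiagonal+diagonal : ∀ {n} (f : Fin n → Fin n → ℕ) →
    ∑² (λ u w → ⟦ not (u =ᶠ w) ⟧ * f u w) + sum (λ u → f u u) ≡ ∑² f
  ∑²-offDiagonal+diagonal f = begin
    ∑² (λ u w → ⟦ not (u =ᶠ w) ⟧ * f u w) + sum (λ u → f u u)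
      ≡⟨ cong (∑² (λ u w → ⟦ not (u =ᶠ w) ⟧ * f u w) +_) (sum-cong-≗ λ u → sym (sum-δ u (f u))) ⟩
    ∑² (λ u w → ⟦ not (u =ᶠ w) ⟧ * f u w) + ∑² (λ u w → ⟦ u =ᶠ w ⟧ * f u w)
      ≡⟨ sym (∑²-distrib-+ (λ u w → ⟦ not (u =ᶠ w) ⟧ * f u w) (λ u w → ⟦ u =ᶠ w ⟧ * f u w)) ⟩
    ∑² (λ u w → ⟦ not (u =ᶠ w) ⟧ * f u w + ⟦ u =ᶠ w ⟧ * f u w)
      ≡⟨ ∑²-cong (λ u w → trans (sym (*-distribʳ-+ (f u w) ⟦ not (u =ᶠ w) ⟧ ⟦ u =ᶠ w ⟧))
                                (trans (cong (_* f u w) (⟦not⟧+⟦⟧≡1 (u =ᶠ w))) (*-identityˡ (f u w)))) ⟩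
    ∑² f ∎
    where open ≡-Reasoning

  ∑³ : ∀ {n} → (Fin n → Fin n → Fin n → ℕ) → ℕ
  ∑³ F = sum λ v → ∑² (F v)

  ∑∑∑≡∑³ : ∀ {n} (F : Fin n → Fin n → Fin n → ℕ) → ∑ (λ v → ∑ λ u → ∑ λ w → F v u w) ≡ ∑³ F
  ∑∑∑≡∑³ F = trans (∑≡sum λ v → ∑ λ u → ∑ (F v u))
    (sum-cong-≗ λ v → trans (∑≡sum λ u → ∑ (F v u)) (sum-cong-≗ λ u → ∑≡sum (F v u)))

  ∑³-cong : ∀ {n} {F G : Fin n → Fin n → Fin n → ℕ} → (∀ v u w → F v u w ≡ G v u w) → ∑³ F ≡ ∑³ G
  ∑³-cong F≡G = sum-cong-≗ λ v → ∑²-cong (F≡G v)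

  ∑³-distrib-+ : ∀ {n} (F G : Fin n → Fin n → Fin n → ℕ) →
    ∑³ (λ v u w → F v u w + G v u w) ≡ ∑³ F + ∑³ G
  ∑³-distrib-+ F G = trans (sum-cong-≗ λ v → ∑²-distrib-+ (F v) (G v))
                           (∑-distrib-+ (λ v → ∑² (F v)) (λ v → ∑² (G v)))

  *-distribˡ-∑³ : ∀ {n} k (F : Fin n → Fin n → Fin n → ℕ) → k * ∑³ F ≡ ∑³ (λ v u w → k * F v u w)
  *-distribˡ-∑³ k F = trans (*-distribˡ-sum k λ v → ∑² (F v)) (sum-cong-≗ λ v → *-distribˡ-∑² k (F v))

  ∑³-rotate : ∀ {n} (F : Fin n → Fin n → Fin n → ℕ) → ∑³ (λ v u w → F u w v) ≡ ∑³ F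
  ∑³-rotate F = trans (∑-comm λ v u → sum λ w → F u w v) (sum-cong-≗ λ u → ∑-comm λ v w → F u w v)

  ∑³-cyclic : ∀ {n} (F : Fin n → Fin n → Fin n → ℕ) →
    ∑³ (λ v u w → F v u w + F u w v + F w v u) ≡ 3 * ∑³ F
  ∑³-cyclic F = begin
    ∑³ (λ v u w → F v u w + F u w v + F w v u)
      ≡⟨ trans (∑³-distrib-+ (λ v u w → F v u w + F u w v) (λ v u w → F w v u))
               (cong (_+ ∑³ (λ v u w → F w v u)) (∑³-distrib-+ F (λ v u w → F u w v))) ⟩
    ∑³ F + ∑³ (λ v u w → F u w v) + ∑³ (λ v u w → F w v u)
      ≡⟨ cong₂ (λ x y → ∑³ F + x + y) (∑³-rotate F) (trans (∑³-rotate (λ v u w → F u w v)) (∑³-rotate F)) ⟩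
    ∑³ F + ∑³ F + ∑³ F
      ≡⟨ x+x+x≡3x (∑³ F) ⟩
    3 * ∑³ F ∎
    where
    open ≡-Reasoning
    x+x+x≡3x : ∀ x → x + x + x ≡ 3 * x
    x+x+x≡3x = solve-∀

  ⟦<⟧+⟦>⟧≡⟦≢⟧ : ∀ {n} (u w : Fin n) → ⟦ does (u <? w) ⟧ + ⟦ does (w <? u) ⟧ ≡ ⟦ not (u =ᶠ w) ⟧
  ⟦<⟧+⟦>⟧≡⟦≢⟧ u w with <-cmp u w
  ... | tri< u<w u≢w w≮u
    rewrite dec-true (u <? w) u<w | dec-false (w <? u) w≮u | dec-false (u ≟ w) u≢w = refl
  ... | tri≈ u≮w refl _
    rewrite dec-false (u <? u) u≮w | dec-true (u ≟ u) refl = refl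
  ... | tri> u≮w u≢w w<u
    rewrite dec-false (u <? w) u≮w | dec-true (w <? u) w<u | dec-false (u ≟ w) u≢w = refl

  2*∑²<≡∑²≢ : ∀ {n} (f : Fin n → Fin n → ℕ) → (∀ u w → f u w ≡ f w u) →
    2 * ∑² (λ u w → ⟦ does (u <? w) ⟧ * f u w) ≡ ∑² (λ u w → ⟦ not (u =ᶠ w) ⟧ * f u w)
  2*∑²<≡∑²≢ f f-sym = begin
    2 * A
      ≡⟨ cong (A +_) (+-identityʳ A) ⟩
    A + A
      ≡⟨ cong (A +_) (trans (∑-comm λ u w → ⟦ does (u <? w) ⟧ * f u w)
                            (∑²-cong λ u w → cong (⟦ does (w <? u) ⟧ *_) (f-sym w u))) ⟩
    A + ∑² (λ u w → ⟦ does (w <? u) ⟧ * f u w)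
      ≡⟨ sym (∑²-distrib-+ (λ u w → ⟦ does (u <? w) ⟧ * f u w) (λ u w → ⟦ does (w <? u) ⟧ * f u w)) ⟩
    ∑² (λ u w → ⟦ does (u <? w) ⟧ * f u w + ⟦ does (w <? u) ⟧ * f u w)
      ≡⟨ ∑²-cong (λ u w → trans (sym (*-distribʳ-+ (f u w) ⟦ does (u <? w) ⟧ ⟦ does (w <? u) ⟧))
                                (cong (_* f u w) (⟦<⟧+⟦>⟧≡⟦≢⟧ u w))) ⟩
    ∑² (λ u w → ⟦ not (u =ᶠ w) ⟧ * f u w) ∎
    where
    open ≡-Reasoning
    A = ∑² (λ u w → ⟦ does (u <? w) ⟧ * f u w)

  sameColour : ∀ x y a b →
    ⟦ (not x ∧ not y) ∧ (a =ᵇ b) ⟧ ≡ ⟦ not x ∧ a ⟧ * ⟦ not y ∧ b ⟧ + ⟦ not x ∧ not a ⟧ * ⟦ not y ∧ not b ⟧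
  sameColour true  y     a     b     = refl
  sameColour false true  false b     = refl
  sameColour false true  true  b     = refl
  sameColour false false false false = refl
  sameColour false false false true  = refl
  sameColour false false true  false = refl
  sameColour false false true  true  = refl

  differentColour : ∀ x y a b →
    ⟦ (not x ∧ not y) ∧ not (a =ᵇ b) ⟧ ≡ ⟦ not x ∧ a ⟧ * ⟦ not y ∧ not b ⟧ + ⟦ not x ∧ not a ⟧ * ⟦ not y ∧ b ⟧
  differentColour true  y     a     b     = refl
  differentColour false true  false b     = refl
  differentColour false true  true  b     = refl
  differentColour false false false false = refl
  differentColour false false false true  = refl
  differentColour false false true  false = refl
  differentColour false false true  true  = refl

  colour-partition : ∀ x a → ⟦ x ⟧ + (⟦ not x ∧ a ⟧ + ⟦ not x ∧ not a ⟧) ≡ 1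
  colour-partition false false = refl
  colour-partition false true  = refl
  colour-partition true  a     = refl

  allEqual-comm : ∀ a b d → (a =ᵇ b) ∧ (d =ᵇ a) ≡ (b =ᵇ a) ∧ (d =ᵇ b)
  allEqual-comm false false d = refl
  allEqual-comm false true  d = refl
  allEqual-comm true  false d = refl
  allEqual-comm true  true  d = refl

  -- The wedges centred at v, u, w of a triple with distinctness flag D and colours a = c v u,
  -- b = c v w, d = c u w.
  triangle-wedges : ∀ D a b d →
    let m : Bool → ℕ
        m e = ⟦ D ∧ e ⟧
    in 2 * (m (a =ᵇ b) + m (d =ᵇ a) + m (b =ᵇ d))
       ≡ 2 * (m ((a =ᵇ b) ∧ (d =ᵇ a)) + m ((d =ᵇ a) ∧ (b =ᵇ d)) + m ((b =ᵇ d) ∧ (a =ᵇ b)))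
         + (m (not (a =ᵇ b)) + m (not (d =ᵇ a)) + m (not (b =ᵇ d)))
  triangle-wedges false a     b     d     = refl
  triangle-wedges true  false false false = refl
  triangle-wedges true  false false true  = refl
  triangle-wedges true  false true  false = refl
  triangle-wedges true  false true  true  = refl
  triangle-wedges true  true  false false = refl
  triangle-wedges true  true  false true  = refl
  triangle-wedges true  true  true  false = refl
  triangle-wedges true  true  true  true  = refl

  m*[n*o]≡n*[m*o] : ∀ m n o → m * (n * o) ≡ n * (m * o)
  m*[n*o]≡n*[m*o] = solve-∀

  mn+nm≤m²+n²-ordered : ∀ {m n} → m ≤ n → m * n + n * m ≤ m * m + n * n
  mn+nm≤m²+n²-ordered {m} {n} m≤n = subst (λ n → m * n + n * m ≤ m * m + n * n) (m+[n∸m]≡n m≤n)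
    (subst (m * (m + d) + (m + d) * m ≤_) (square-gap m d) (m≤m+n _ (d * d)))
    where
    d = n ∸ m
    square-gap : ∀ m d → m * (m + d) + (m + d) * m + d * d ≡ m * m + (m + d) * (m + d)
    square-gap = solve-∀

  mn+nm≤m²+n² : ∀ m n → m * n + n * m ≤ m * m + n * n
  mn+nm≤m²+n² m n with ≤-total m n
  ... | inj₁ m≤n = mn+nm≤m²+n²-ordered m≤n
  ... | inj₂ n≤m = subst₂ _≤_ (+-comm (n * m) (m * n)) (+-comm (n * n) (m * m)) (mn+nm≤m²+n²-ordered n≤m)

  wedge-count-bound : ∀ k r b M → M + (r + b) ≡ r * r + b * b → 4 + k ≤ r + b →
    (2 + k) * (r * b + b * r) ≤ (4 + k) * M
  wedge-count-bound k r b M M+n≡s 4+k≤n = begin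
    (2 + k) * (r * b + b * r)   ≤⟨ *-monoʳ-≤ (2 + k) (mn+nm≤m²+n² r b) ⟩
    (2 + k) * (r * r + b * b)   ≡⟨ cong ((2 + k) *_) (sym M+n≡s) ⟩
    (2 + k) * (M + n)           ≡⟨ *-distribˡ-+ (2 + k) M n ⟩
    (2 + k) * M + (2 + k) * n   ≤⟨ +-monoʳ-≤ ((2 + k) * M) [2+k]n≤2M ⟩
    (2 + k) * M + 2 * M         ≡⟨ add-two k M ⟩
    (4 + k) * M                 ∎
    where
    open ≤-Reasoning
    n = r + b
    add-two : ∀ k x → (2 + k) * x + 2 * x ≡ (4 + k) * x
    add-two = solve-∀
    square-sum : ∀ r b → (r + b) * (r + b) ≡ r * r + b * b + (r * b + b * r)
    square-sum = solve-∀
    double-sum : ∀ x y → x + y + (x + y) ≡ 2 * x + 2 * y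
    double-sum = solve-∀
    [2+k]n≤2M : (2 + k) * n ≤ 2 * M
    [2+k]n≤2M = +-cancelʳ-≤ (2 * n) ((2 + k) * n) (2 * M) (begin
      (2 + k) * n + 2 * n                   ≡⟨ add-two k n ⟩
      (4 + k) * n                           ≤⟨ *-monoˡ-≤ n 4+k≤n ⟩
      n * n                                 ≡⟨ square-sum r b ⟩
      r * r + b * b + (r * b + b * r)       ≤⟨ +-monoʳ-≤ (r * r + b * b) (mn+nm≤m²+n² r b) ⟩
      r * r + b * b + (r * r + b * b)       ≡⟨ cong₂ _+_ (sym M+n≡s) (sym M+n≡s) ⟩
      M + n + (M + n)                       ≡⟨ double-sum M n ⟩
      2 * M + 2 * n                         ∎)

  goodman⇒ratio : ∀ k M T Q → 2 * M ≡ 2 * T + Q → (2 + k) * Q ≤ (4 + k) * M → k * M ≤ 2 * (2 + k) * T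
  goodman⇒ratio k M T Q 2M≡2T+Q Q-bound = +-cancelʳ-≤ ((4 + k) * M) (k * M) (2 * (2 + k) * T) (begin
    k * M + (4 + k) * M           ≡⟨ split k M ⟩
    (2 + k) * (2 * M)             ≡⟨ cong ((2 + k) *_) 2M≡2T+Q ⟩
    (2 + k) * (2 * T + Q)         ≡⟨ regroup k T Q ⟩
    2 * (2 + k) * T + (2 + k) * Q ≤⟨ +-monoʳ-≤ (2 * (2 + k) * T) Q-bound ⟩
    2 * (2 + k) * T + (4 + k) * M ∎)
    where
    split : ∀ k M → k * M + (4 + k) * M ≡ (2 + k) * (2 * M)
    split = solve-∀
    regroup : ∀ k T Q → (2 + k) * (2 * T + Q) ≡ 2 * (2 + k) * T + (2 + k) * Q
    regroup = solve-∀
    open ≤-Reasoning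

  module Wedges {N : ℕ} (c : Colouring N) (c-sym : Symmetric c) where

    distinct : Fin N → Fin N → Fin N → Bool
    distinct v u w = not (u =ᶠ w) ∧ not (u =ᶠ v) ∧ not (w =ᶠ v)

    monoWedge closedWedge bichromaticWedge : Fin N → Fin N → Fin N → ℕ
    monoWedge        v u w = ⟦ distinct v u w ∧ (c v u =ᵇ c v w) ⟧
    closedWedge      v u w = ⟦ distinct v u w ∧ ((c v u =ᵇ c v w) ∧ (c u w =ᵇ c v u)) ⟧
    bichromaticWedge v u w = ⟦ distinct v u w ∧ not (c v u =ᵇ c v w) ⟧

    2*paths≡wedges-at : ∀ v (P : Fin N → Fin N → Bool) → (∀ u w → P u w ≡ P w u) →
      2 * ∑² (λ u w → ⟦ isPath2 v u w ∧ P u w ⟧) ≡ ∑² (λ u w → ⟦ distinct v u w ∧ P u w ⟧)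
    2*paths≡wedges-at v P P-sym = begin
      2 * ∑² (λ u w → ⟦ isPath2 v u w ∧ P u w ⟧)
        ≡⟨ cong (2 *_) (∑²-cong λ u w → factor (does (u <? w)) u w) ⟩
      2 * ∑² (λ u w → ⟦ does (u <? w) ⟧ * f u w)
        ≡⟨ 2*∑²<≡∑²≢ f f-sym ⟩
      ∑² (λ u w → ⟦ not (u =ᶠ w) ⟧ * f u w)
        ≡⟨ ∑²-cong (λ u w → sym (factor (not (u =ᶠ w)) u w)) ⟩
      ∑² (λ u w → ⟦ distinct v u w ∧ P u w ⟧) ∎
      where
      open ≡-Reasoning
      f : Fin N → Fin N → ℕ
      f u w = ⟦ (not (u =ᶠ v) ∧ not (w =ᶠ v)) ∧ P u w ⟧
      f-sym : ∀ u w → f u w ≡ f w u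
      f-sym u w = cong ⟦_⟧ (cong₂ _∧_ (∧-comm (not (u =ᶠ v)) (not (w =ᶠ v))) (P-sym u w))
      factor : ∀ x u w → ⟦ (x ∧ not (u =ᶠ v) ∧ not (w =ᶠ v)) ∧ P u w ⟧ ≡ ⟦ x ⟧ * f u w
      factor x u w = trans (cong ⟦_⟧ (∧-assoc x _ (P u w))) (⟦⟧-homo-∧ x _)

    2*paths≡wedges : (P : Fin N → Fin N → Fin N → Bool) → (∀ v u w → P v u w ≡ P v w u) →
      2 * ∑³ (λ v u w → ⟦ isPath2 v u w ∧ P v u w ⟧) ≡ ∑³ (λ v u w → ⟦ distinct v u w ∧ P v u w ⟧)
    2*paths≡wedges P P-sym = begin
      2 * ∑³ (λ v u w → ⟦ isPath2 v u w ∧ P v u w ⟧)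
        ≡⟨ *-distribˡ-sum 2 (λ v → ∑² λ u w → ⟦ isPath2 v u w ∧ P v u w ⟧) ⟩
      sum (λ v → 2 * ∑² (λ u w → ⟦ isPath2 v u w ∧ P v u w ⟧))
        ≡⟨ sum-cong-≗ (λ v → 2*paths≡wedges-at v (P v) (P-sym v)) ⟩
      ∑³ (λ v u w → ⟦ distinct v u w ∧ P v u w ⟧) ∎
      where open ≡-Reasoning

    2*monoPaths≡monoWedges : 2 * monoPaths c ≡ ∑³ monoWedge
    2*monoPaths≡monoWedges = trans
      (cong (2 *_) (∑∑∑≡∑³ λ v u w → ⟦ isMonoPath2 c v u w ⟧))
      (2*paths≡wedges (λ v u w → c v u =ᵇ c v w) (λ v u w → =ᵇ-comm (c v u) (c v w)))

    2*monoPathsInTriangle≡closedWedges : 2 * monoPathsInTriangle c ≡ ∑³ closedWedge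
    2*monoPathsInTriangle≡closedWedges = trans
      (cong (2 *_) (trans (∑∑∑≡∑³ λ v u w → ⟦ isMonoPath2InTriangle c v u w ⟧)
                          (∑³-cong λ v u w → cong ⟦_⟧ (∧-assoc (isPath2 v u w) (c v u =ᵇ c v w) (c u w =ᵇ c v u)))))
      (2*paths≡wedges (λ v u w → (c v u =ᵇ c v w) ∧ (c u w =ᵇ c v u)) closed-sym)
      where
      closed-sym : ∀ v u w → (c v u =ᵇ c v w) ∧ (c u w =ᵇ c v u) ≡ (c v w =ᵇ c v u) ∧ (c w u =ᵇ c v w)
      closed-sym v u w = trans (allEqual-comm (c v u) (c v w) (c u w))
                               (cong (λ x → (c v w =ᵇ c v u) ∧ (x =ᵇ c v w)) (c-sym u w))

    distinct-rotate : ∀ v u w → distinct u w v ≡ distinct v u w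
    distinct-rotate v u w =
      trans (cong₂ (λ z x → not (w =ᶠ v) ∧ not z ∧ not x) (=ᶠ-comm w u) (=ᶠ-comm v u))
            (trans (∧-comm (not (w =ᶠ v)) _) (∧-assoc (not (u =ᶠ w)) (not (u =ᶠ v)) (not (w =ᶠ v))))

    wedges-of-triangle : ∀ v u w →
      2 * (monoWedge v u w + monoWedge u w v + monoWedge w v u)
      ≡ 2 * (closedWedge v u w + closedWedge u w v + closedWedge w v u)
        + (bichromaticWedge v u w + bichromaticWedge u w v + bichromaticWedge w v u)
    wedges-of-triangle v u w
      rewrite distinct-rotate u w v | distinct-rotate v u w | c-sym u v | c-sym w v | c-sym w u
      = triangle-wedges (distinct v u w) (c v u) (c v w) (c u w)

    goodman-identity : 2 * ∑³ monoWedge ≡ 2 * ∑³ closedWedge + ∑³ bichromaticWedge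
    goodman-identity = *-cancelˡ-≡ _ _ 3 (begin
      3 * (2 * ∑³ monoWedge)
        ≡⟨ m*[n*o]≡n*[m*o] 3 2 (∑³ monoWedge) ⟩
      2 * (3 * ∑³ monoWedge)
        ≡⟨ cong (2 *_) (sym (∑³-cyclic monoWedge)) ⟩
      2 * ∑³ (cyclic monoWedge)
        ≡⟨ *-distribˡ-∑³ 2 (cyclic monoWedge) ⟩
      ∑³ (λ v u w → 2 * cyclic monoWedge v u w)
        ≡⟨ ∑³-cong wedges-of-triangle ⟩
      ∑³ (λ v u w → 2 * cyclic closedWedge v u w + cyclic bichromaticWedge v u w)
        ≡⟨ ∑³-distrib-+ (λ v u w → 2 * cyclic closedWedge v u w) (cyclic bichromaticWedge) ⟩
      ∑³ (λ v u w → 2 * cyclic closedWedge v u w) + ∑³ (cyclic bichromaticWedge)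
        ≡⟨ cong₂ _+_ (trans (sym (*-distribˡ-∑³ 2 (cyclic closedWedge))) (cong (2 *_) (∑³-cyclic closedWedge)))
                     (∑³-cyclic bichromaticWedge) ⟩
      2 * (3 * ∑³ closedWedge) + 3 * ∑³ bichromaticWedge
        ≡⟨ factor-3 (∑³ closedWedge) (∑³ bichromaticWedge) ⟩
      3 * (2 * ∑³ closedWedge + ∑³ bichromaticWedge) ∎)
      where
      open ≡-Reasoning
      cyclic : (Fin N → Fin N → Fin N → ℕ) → Fin N → Fin N → Fin N → ℕ
      cyclic F v u w = F v u w + F u w v + F w v u
      factor-3 : ∀ x y → 2 * (3 * x) + 3 * y ≡ 3 * (2 * x + y)
      factor-3 = solve-∀

    module Centre (v : Fin N) where

      redNbr blueNbr : Fin N → ℕ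
      redNbr  u = ⟦ not (u =ᶠ v) ∧ c v u ⟧
      blueNbr u = ⟦ not (u =ᶠ v) ∧ not (c v u) ⟧

      redDeg blueDeg : ℕ
      redDeg  = sum redNbr
      blueDeg = sum blueNbr

      degrees : suc (redDeg + blueDeg) ≡ N
      degrees = begin
        1 + (redDeg + blueDeg)
          ≡⟨ cong₂ _+_ (sym loops) (sym (∑-distrib-+ redNbr blueNbr)) ⟩
        sum (λ u → ⟦ u =ᶠ v ⟧) + sum (λ u → redNbr u + blueNbr u)
          ≡⟨ sym (∑-distrib-+ (λ u → ⟦ u =ᶠ v ⟧) (λ u → redNbr u + blueNbr u)) ⟩
        sum (λ u → ⟦ u =ᶠ v ⟧ + (redNbr u + blueNbr u))
          ≡⟨ sum-cong-≗ (λ u → colour-partition (u =ᶠ v) (c v u)) ⟩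
        sum (λ (_ : Fin N) → 1)
          ≡⟨ sum-ones N ⟩
        N ∎
        where
        open ≡-Reasoning
        loops : sum (λ u → ⟦ u =ᶠ v ⟧) ≡ 1
        loops = begin
          sum (λ u → ⟦ u =ᶠ v ⟧)
            ≡⟨ sum-cong-≗ (λ u → trans (cong ⟦_⟧ (=ᶠ-comm u v)) (sym (*-identityʳ ⟦ v =ᶠ u ⟧))) ⟩
          sum (λ u → ⟦ v =ᶠ u ⟧ * 1)
            ≡⟨ sum-δ v (λ _ → 1) ⟩
          1 ∎

      monoWedge≡nbrs : ∀ u w →
        monoWedge v u w ≡ ⟦ not (u =ᶠ w) ⟧ * (redNbr u * redNbr w + blueNbr u * blueNbr w)
      monoWedge≡nbrs u w = trans (cong ⟦_⟧ (∧-assoc (not (u =ᶠ w)) _ _))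
        (trans (⟦⟧-homo-∧ (not (u =ᶠ w)) _)
               (cong (⟦ not (u =ᶠ w) ⟧ *_) (sameColour (u =ᶠ v) (w =ᶠ v) (c v u) (c v w))))

      bichromaticWedge≡nbrs : ∀ u w →
        bichromaticWedge v u w ≡ ⟦ not (u =ᶠ w) ⟧ * (redNbr u * blueNbr w + blueNbr u * redNbr w)
      bichromaticWedge≡nbrs u w = trans (cong ⟦_⟧ (∧-assoc (not (u =ᶠ w)) _ _))
        (trans (⟦⟧-homo-∧ (not (u =ᶠ w)) _)
               (cong (⟦ not (u =ᶠ w) ⟧ *_) (differentColour (u =ᶠ v) (w =ᶠ v) (c v u) (c v w))))

      monoWedges+degree : ∑² (monoWedge v) + (redDeg + blueDeg) ≡ redDeg * redDeg + blueDeg * blueDeg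
      monoWedges+degree = begin
        ∑² (monoWedge v) + (redDeg + blueDeg)
          ≡⟨ cong₂ _+_ (∑²-cong monoWedge≡nbrs) (sym diagonal) ⟩
        ∑² (λ u w → ⟦ not (u =ᶠ w) ⟧ * sameNbr u w) + sum (λ u → sameNbr u u)
          ≡⟨ ∑²-offDiagonal+diagonal sameNbr ⟩
        ∑² sameNbr
          ≡⟨ ∑²-distrib-+ (λ u w → redNbr u * redNbr w) (λ u w → blueNbr u * blueNbr w) ⟩
        ∑² (λ u w → redNbr u * redNbr w) + ∑² (λ u w → blueNbr u * blueNbr w)
          ≡⟨ cong₂ _+_ (∑²-product redNbr redNbr) (∑²-product blueNbr blueNbr) ⟩
        redDeg * redDeg + blueDeg * blueDeg ∎
        where
        open ≡-Reasoning
        sameNbr : Fin N → Fin N → ℕ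
        sameNbr u w = redNbr u * redNbr w + blueNbr u * blueNbr w
        diagonal : sum (λ u → sameNbr u u) ≡ redDeg + blueDeg
        diagonal = trans
          (sum-cong-≗ λ u → cong₂ _+_ (⟦⟧-idem (not (u =ᶠ v) ∧ c v u)) (⟦⟧-idem (not (u =ᶠ v) ∧ not (c v u))))
          (∑-distrib-+ redNbr blueNbr)

      bichromaticWedges≤ : ∑² (bichromaticWedge v) ≤ redDeg * blueDeg + blueDeg * redDeg
      bichromaticWedges≤ = begin
        ∑² (bichromaticWedge v)
          ≡⟨ ∑²-cong bichromaticWedge≡nbrs ⟩
        ∑² (λ u w → ⟦ not (u =ᶠ w) ⟧ * differentNbr u w)
          ≤⟨ ∑²-mono-≤ (λ u w → ⟦⟧*n≤n (not (u =ᶠ w)) (differentNbr u w)) ⟩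
        ∑² differentNbr
          ≡⟨ ∑²-distrib-+ (λ u w → redNbr u * blueNbr w) (λ u w → blueNbr u * redNbr w) ⟩
        ∑² (λ u w → redNbr u * blueNbr w) + ∑² (λ u w → blueNbr u * redNbr w)
          ≡⟨ cong₂ _+_ (∑²-product redNbr blueNbr) (∑²-product blueNbr redNbr) ⟩
        redDeg * blueDeg + blueDeg * redDeg ∎
        where
        open ≤-Reasoning
        differentNbr : Fin N → Fin N → ℕ
        differentNbr u w = redNbr u * blueNbr w + blueNbr u * redNbr w

      bichromatic≤monochromatic-at : ∀ k → 5 + k ≤ N →
        (2 + k) * ∑² (bichromaticWedge v) ≤ (4 + k) * ∑² (monoWedge v)
      bichromatic≤monochromatic-at k 5+k≤N = ≤-trans (*-monoʳ-≤ (2 + k) bichromaticWedges≤)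
        (wedge-count-bound k redDeg blueDeg (∑² (monoWedge v)) monoWedges+degree 4+k≤deg)
        where
        4+k≤deg : 4 + k ≤ redDeg + blueDeg
        4+k≤deg = s≤s⁻¹ (subst (5 + k ≤_) (sym degrees) 5+k≤N)

    bichromatic≤monochromatic : ∀ k → 5 + k ≤ N → (2 + k) * ∑³ bichromaticWedge ≤ (4 + k) * ∑³ monoWedge
    bichromatic≤monochromatic k 5+k≤N = subst₂ _≤_
      (sym (*-distribˡ-sum (2 + k) λ v → ∑² (bichromaticWedge v)))
      (sym (*-distribˡ-sum (4 + k) λ v → ∑² (monoWedge v)))
      (sum-mono-≤ λ v → Centre.bichromatic≤monochromatic-at v k 5+k≤N)

  monoPaths-ratio : ∀ {N} (c : Colouring N) → Symmetric c → ∀ k → 5 + k ≤ N →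
    k * monoPaths c ≤ 2 * (2 + k) * monoPathsInTriangle c
  monoPaths-ratio c c-sym k 5+k≤N = *-cancelˡ-≤ 2 (begin
    2 * (k * monoPaths c)
      ≡⟨ m*[n*o]≡n*[m*o] 2 k (monoPaths c) ⟩
    k * (2 * monoPaths c)
      ≡⟨ cong (k *_) 2*monoPaths≡monoWedges ⟩
    k * ∑³ monoWedge
      ≤⟨ goodman⇒ratio k (∑³ monoWedge) (∑³ closedWedge) (∑³ bichromaticWedge)
                       goodman-identity (bichromatic≤monochromatic k 5+k≤N) ⟩
    2 * (2 + k) * ∑³ closedWedge
      ≡⟨ cong (2 * (2 + k) *_) 2*monoPathsInTriangle≡closedWedges ⟨
    2 * (2 + k) * (2 * monoPathsInTriangle c)
      ≡⟨ m*[n*o]≡n*[m*o] (2 * (2 + k)) 2 (monoPathsInTriangle c) ⟩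
    2 * (2 * (2 + k) * monoPathsInTriangle c) ∎)
    where
    open Wedges c c-sym
    open ≤-Reasoning

open Counting using (monoPaths-ratio)

open import Data.Nat as ℕ using (ℕ; zero; suc; _∸_; _≥_; z≤n)
import Data.Nat.Properties as ℕ
open import Data.Nat.Coprimality using (Coprime; 1-coprimeTo; sym)
open import Data.Nat.Tactic.RingSolver using (solve-∀)
open import Data.Integer as ℤ using (+_; +[1+_]; +0; -[1+_]; +≤+; -≤+; +<+)
import Data.Integer.Properties as ℤ
open import Data.Integer.Tactic.RingSolver using () renaming (solve-∀ to ℤ-solve-∀)
open import Data.Product using (∃; _,_)
open import Data.Rational using (ℚ; mkℚ; 0ℚ; ½; _/_; _-_; -_; _*_; _≤_; _<_; *<*)
open import Data.Rational.Properties using (normalize-coprime; toℚᵘ-cancel-≤; toℚᵘ-homo-*; toℚᵘ-homo-+)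
import Data.Rational.Unnormalised as ℚᵘ
import Data.Rational.Unnormalised.Properties as ℚᵘ
open import Relation.Binary.PropositionalEquality using (_≡_; trans; cong; subst₂)

/1≡mkℚ : ∀ m → + m / 1 ≡ mkℚ (+ m) 0 (sym (1-coprimeTo m))
/1≡mkℚ m = normalize-coprime (sym (1-coprimeTo m))

-- mkℚ stores the denominator minus one: here ε = (1 + a) / (1 + d).
½-ε-clear-denominators : ∀ a d .(c : Coprime (suc a) (suc d)) M T →
  (+[1+ d ] ℤ.- + 2 ℤ.* +[1+ a ]) ℤ.* + M ℤ.≤ + (2 ℕ.* suc d ℕ.* T) →
  (½ - mkℚ +[1+ a ] d c) * (+ M / 1) ≤ + T / 1
½-ε-clear-denominators a d c M T cleared rewrite /1≡mkℚ M | /1≡mkℚ T = toℚᵘ-cancel-≤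
  (ℚᵘ.≤-respˡ-≃ (ℚᵘ.≃-sym (ℚᵘ.≃-trans (toℚᵘ-homo-* (½ - ε) (mkℚ (+ M) 0 _))
                                      (ℚᵘ.*-congʳ (toℚᵘ-homo-+ ½ (- ε)))))
                (ℚᵘ.*≤* (subst₂ ℤ._≤_ (numerator +[1+ d ] +[1+ a ] (+ M)) denominator cleared)))
  where
  ε = mkℚ +[1+ a ] d c
  numerator : ∀ x y m → (x ℤ.- + 2 ℤ.* y) ℤ.* m ≡ ((+ 1 ℤ.* x ℤ.+ ℤ.- y ℤ.* + 2) ℤ.* m) ℤ.* + 1
  numerator = ℤ-solve-∀
  reorder : ∀ d t → 2 ℕ.* suc d ℕ.* t ≡ t ℕ.* (2 ℕ.* suc d ℕ.* 1)
  reorder = solve-∀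
  denominator : + (2 ℕ.* suc d ℕ.* T) ≡ + T ℤ.* + (2 ℕ.* suc d ℕ.* 1)
  denominator = trans (cong +_ (reorder d T)) (ℤ.pos-* T _)

[1+d]-2≤d∸1 : ∀ d → +[1+ d ] ℤ.- + 2 ℤ.≤ + (d ∸ 1)
[1+d]-2≤d∸1 zero    = -≤+
[1+d]-2≤d∸1 (suc d) = ℤ.≤-refl

½-ε-numerator-bound : ∀ a d M T → (d ∸ 1) ℕ.* M ℕ.≤ 2 ℕ.* suc d ℕ.* T →
  (+[1+ d ] ℤ.- + 2 ℤ.* +[1+ a ]) ℤ.* + M ℤ.≤ + (2 ℕ.* suc d ℕ.* T)
½-ε-numerator-bound a d M T bound = begin
  (+[1+ d ] ℤ.- + 2 ℤ.* +[1+ a ]) ℤ.* + M ≤⟨ ℤ.*-monoʳ-≤-nonNeg (+ M) numerator≤d∸1 ⟩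
  + (d ∸ 1) ℤ.* + M                       ≡⟨ ℤ.pos-* (d ∸ 1) M ⟨
  + ((d ∸ 1) ℕ.* M)                       ≤⟨ +≤+ bound ⟩
  + (2 ℕ.* suc d ℕ.* T)                   ∎
  where
  open ℤ.≤-Reasoning
  2≤2[1+a] : + 2 ℤ.≤ + 2 ℤ.* +[1+ a ]
  2≤2[1+a] = ℤ.≤-trans (+≤+ (ℕ.m≤m*n 2 (suc a))) (ℤ.≤-reflexive (ℤ.pos-* 2 (suc a)))
  numerator≤d∸1 : +[1+ d ] ℤ.- + 2 ℤ.* +[1+ a ] ℤ.≤ + (d ∸ 1)
  numerator≤d∸1 = ℤ.≤-trans (ℤ.+-monoʳ-≤ +[1+ d ] (ℤ.neg-mono-≤ 2≤2[1+a])) ([1+d]-2≤d∸1 d)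

½-ε-bound : ∀ a d .(c : Coprime (suc a) (suc d)) M T → (d ∸ 1) ℕ.* M ℕ.≤ 2 ℕ.* suc d ℕ.* T →
  (½ - mkℚ +[1+ a ] d c) * (+ M / 1) ≤ + T / 1
½-ε-bound a d c M T bound = ½-ε-clear-denominators a d c M T (½-ε-numerator-bound a d M T bound)

proposition13 : (ε : ℚ) → 0ℚ < ε →
    ∃ λ (N₀ : ℕ) → (N : ℕ) → N ≥ N₀ → (c : Colouring N) → Symmetric c →
    (½ - ε) * ((+ monoPaths c) / 1) ≤ (+ monoPathsInTriangle c) / 1
proposition13 (mkℚ +[1+ a ] zero cop) _ =
  0 , λ _ _ c _ → ½-ε-bound a 0 cop (monoPaths c) (monoPathsInTriangle c) z≤n
proposition13 (mkℚ +[1+ a ] (suc k) cop) _ =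
  5 ℕ.+ k , λ _ 5+k≤N c c-sym →
    ½-ε-bound a (suc k) cop (monoPaths c) (monoPathsInTriangle c) (monoPaths-ratio c c-sym k 5+k≤N)
proposition13 (mkℚ +0 _ _) (*<* (+<+ ()))
proposition13 (mkℚ -[1+ _ ] _ _) (*<* ())
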